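{- Assume function extensionality. Let $X$ be a type, $f : X\to X$, $I : \prod_{x:X}(f(f(x)) = f(x))$, and $J : \prod_{x:X}(\mathsf{ap}_f(I(x)) = I(f(x)))$. Then $f$ has a splitting. That is, there exist a type $A$, functions $r:X\to A$ and $s:A\to X$, and homotopies $H:\prod_{a:A}(r(s(a))=a)$ and $K:\prod_{x:X}(s(r(x))=f(x))$.
   Context: We work in intensional Martin-Löf type theory. $\mathsf{ap}_f(p) : f(x)=f(y)$ denotes the action of $f$ on a path $p:x=y$. A triple $(f,I,J)$ as in the claim is called a quasi-idempotent. -}

{-# OPTIONS --without-K #-}
module Defs where

open import Level using (Level; suc)
open import Data.Product using (Σ; Σ-syntax; _×_)
open import Relation.Binary.PropositionalEquality using (_≡_; cong)

HasSplitting : ∀ {ℓ} {X : Set ℓ} → (X → X) → Set (suc ℓ)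
HasSplitting {ℓ} {X} f =
  Σ[ A ∈ Set ℓ ] Σ[ r ∈ (X → A) ] Σ[ s ∈ (A → X) ]
    (((a : A) → r (s a) ≡ a) × ((x : X) → s (r x) ≡ f x))

{-# OPTIONS --without-K #-}
module Submission where

-- A quasi-idempotent (f , I , J) on X splits through the sequential limit
--   Lim f = Σ (a : ℕ → X) , Π n , f (a (n + 1)) = a n
-- with  r x = (const (f x) , const (I x)),  s (a , α) = a 0,  and
-- s (r x) = f x holding definitionally.  The content is r (s w) = w.

open import Defs
open import Level using (Level; 0ℓ)
open import Relation.Binary.PropositionalEquality using (_≡_; cong)
open import Relation.Binary.PropositionalEquality
  using (refl; sym; trans; subst; trans-reflʳ; trans-assoc; trans-cong; module ≡-Reasoning)
open import Axiom.Extensionality.Propositional using (Extensionality)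
open import Data.Nat using (ℕ; zero; suc)
open import Data.Product using (Σ; _,_; proj₁; proj₂)

Lim : ∀ {ℓ} {X : Set ℓ} → (X → X) → Set ℓ
Lim {X = X} f = Σ (ℕ → X) (λ a → (n : ℕ) → f (a (suc n)) ≡ a n)

module LimitPaths {ℓ} {X : Set ℓ} (fe : Extensionality 0ℓ ℓ) (f : X → X) where

  PathsFrom : (ℕ → X) → Set ℓ
  PathsFrom b = Σ (ℕ → X) (λ a → (n : ℕ) → b n ≡ a n)

  singleton-contr : ∀ {x : X} (k : Σ X (λ y → x ≡ y)) → (x , refl) ≡ k
  singleton-contr (_ , refl) = refl

  pathsFrom-contr : (b : ℕ → X) (w : PathsFrom b) → (b , (λ _ → refl)) ≡ w
  pathsFrom-contr b (a , β) = cong unzip (fe (λ n → singleton-contr (a n , β n)))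
    where
      unzip : ((n : ℕ) → Σ X (λ y → b n ≡ y)) → PathsFrom b
      unzip k = (λ n → proj₁ (k n)) , (λ n → proj₂ (k n))

  -- The claim "a coherent β identifies (b , α') with (a , α)", as a
  -- predicate on (a , β) : PathsFrom b, so that it can be transported.
  IdentifiesWith : (b : ℕ → X) (α' : (n : ℕ) → f (b (suc n)) ≡ b n) →
    PathsFrom b → Set ℓ
  IdentifiesWith b α' (a , β) = (α : (n : ℕ) → f (a (suc n)) ≡ a n) →
    ((n : ℕ) → trans (α' n) (β n) ≡ trans (cong f (β (suc n))) (α n)) →
    _≡_ {A = Lim f} (b , α') (a , α)

  -- For β = refl the coherence says α' = α pointwise.
  identifies-refl : (b : ℕ → X) (α' : (n : ℕ) → f (b (suc n)) ≡ b n) →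
    IdentifiesWith b α' (b , (λ _ → refl))
  identifies-refl b α' α coh = cong (b ,_) (fe (λ n → trans (sym (trans-reflʳ (α' n))) (coh n)))

  limit-path : (b : ℕ → X) (α' : (n : ℕ) → f (b (suc n)) ≡ b n) →
    (w : PathsFrom b) → IdentifiesWith b α' w
  limit-path b α' w = subst (IdentifiesWith b α') (pathsFrom-contr b w) (identifies-refl b α')

module QuasiIdempotent {ℓ} {X : Set ℓ} (f : X → X) (I : (x : X) → f (f x) ≡ f x)
                       (J : (x : X) → cong f (I x) ≡ I (f x)) where

  back : ∀ {y z} → f y ≡ z → f z ≡ f y
  back {y} q = trans (sym (cong f q)) (I y)

  I-back-square : ∀ {y z} (q : f y ≡ z) → trans (I z) (back q) ≡ trans (cong f (back q)) (I y)
  I-back-square {y} refl = cong (λ p → trans p (I y)) (sym (J y))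

  cong-back-cancel : ∀ {y z} (q : f y ≡ z) → cong f (trans (back q) q) ≡ I z
  cong-back-cancel {y} refl = trans (cong (cong f) (trans-reflʳ (I y))) (J y)

  module FromHead (a : ℕ → X) (α : (n : ℕ) → f (a (suc n)) ≡ a n) where

    back-shift : (n : ℕ) → f (a 0) ≡ f (a n)
    back-shift zero = refl
    back-shift (suc n) = trans (back-shift n) (back (α n))

    fromHead : (n : ℕ) → f (a 0) ≡ a n
    fromHead n = trans (back-shift (suc n)) (α n)

    I-shift-square : (n : ℕ) →
      trans (I (a 0)) (back-shift n) ≡ trans (cong f (back-shift n)) (I (a n))
    I-shift-square zero = trans-reflʳ (I (a 0))
    I-shift-square (suc n) = begin
      trans (I (a 0)) (trans (back-shift n) (back (α n)))
        ≡⟨ sym (trans-assoc (I (a 0))) ⟩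
      trans (trans (I (a 0)) (back-shift n)) (back (α n))
        ≡⟨ cong (λ p → trans p (back (α n))) (I-shift-square n) ⟩
      trans (trans (cong f (back-shift n)) (I (a n))) (back (α n))
        ≡⟨ trans-assoc (cong f (back-shift n)) ⟩
      trans (cong f (back-shift n)) (trans (I (a n)) (back (α n)))
        ≡⟨ cong (trans (cong f (back-shift n))) (I-back-square (α n)) ⟩
      trans (cong f (back-shift n)) (trans (cong f (back (α n))) (I (a (suc n))))
        ≡⟨ sym (trans-assoc (cong f (back-shift n))) ⟩
      trans (trans (cong f (back-shift n)) (cong f (back (α n)))) (I (a (suc n)))
        ≡⟨ cong (λ p → trans p (I (a (suc n)))) (trans-cong (back-shift n)) ⟩
      trans (cong f (back-shift (suc n))) (I (a (suc n)))
        ∎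
      where open ≡-Reasoning

    cong-fromHead : (n : ℕ) →
      cong f (fromHead (suc n)) ≡ trans (cong f (back-shift (suc n))) (I (a (suc n)))
    cong-fromHead n = begin
      cong f (trans (trans (back-shift (suc n)) (back (α (suc n)))) (α (suc n)))
        ≡⟨ cong (cong f) (trans-assoc (back-shift (suc n))) ⟩
      cong f (trans (back-shift (suc n)) (trans (back (α (suc n))) (α (suc n))))
        ≡⟨ sym (trans-cong (back-shift (suc n))) ⟩
      trans (cong f (back-shift (suc n))) (cong f (trans (back (α (suc n))) (α (suc n))))
        ≡⟨ cong (trans (cong f (back-shift (suc n)))) (cong-back-cancel (α (suc n))) ⟩
      trans (cong f (back-shift (suc n))) (I (a (suc n)))
        ∎
      where open ≡-Reasoning

    fromHead-coherent : (n : ℕ) →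
      trans (I (a 0)) (fromHead n) ≡ trans (cong f (fromHead (suc n))) (α n)
    fromHead-coherent n = begin
      trans (I (a 0)) (trans (back-shift (suc n)) (α n))
        ≡⟨ sym (trans-assoc (I (a 0))) ⟩
      trans (trans (I (a 0)) (back-shift (suc n))) (α n)
        ≡⟨ cong (λ p → trans p (α n)) (I-shift-square (suc n)) ⟩
      trans (trans (cong f (back-shift (suc n))) (I (a (suc n)))) (α n)
        ≡⟨ cong (λ p → trans p (α n)) (sym (cong-fromHead n)) ⟩
      trans (cong f (fromHead (suc n))) (α n)
        ∎
      where open ≡-Reasoning

theorem5p3 : (funext : ∀ {a b : Level} → Extensionality a b) →
    ∀ {ℓ} {X : Set ℓ} (f : X → X) (I : (x : X) → f (f x) ≡ f x) →
    (J : (x : X) → cong f (I x) ≡ I (f x)) → HasSplitting f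
theorem5p3 funext {X = X} f I J = Lim f , r , s , H , (λ x → refl)
  where
    open QuasiIdempotent f I J
    open LimitPaths funext f

    r : X → Lim f
    r x = (λ _ → f x) , (λ _ → I x)

    s : Lim f → X
    s (a , α) = a 0

    H : (w : Lim f) → r (s w) ≡ w
    H (a , α) = limit-path (λ _ → f (a 0)) (λ _ → I (a 0)) (a , fromHead) α fromHead-coherent
      where open FromHead a α
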